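{- Let $d>1$ be a square-free integer, let $\varepsilon=a+b\sqrt{d}$ ($a,b\in\mathbb{Q}$) be the fundamental unit of $\mathbb{Q}(\sqrt{d})$, and for $n\ge1$ write $\varepsilon^n=a_n+b_n\sqrt{d}$ with $a_n,b_n\in\mathbb{Q}$ and $L_n=a_n/a$. Then for every positive integer $k$: (i) $L_{2k-1}$ is a positive integer; (ii) if $a$ is a positive integer, then $aL_{2k}$ is a positive integer and $\gcd(a,aL_{2k})=1$; (iii) if $a=a_0/2$ with $a_0$ an odd integer, then $a_0L_{2k}$ is a positive integer and $\gcd(a_0,a_0L_{2k})=1$.
   Context: The fundamental unit $\varepsilon$ of the real quadratic field $\mathbb{Q}(\sqrt{d})$ is the unit $\varepsilon>1$ of its ring of integers $\mathcal{O}$ such that $\mathcal{O}^*=\{\pm\varepsilon^l: l\in\mathbb{Z}\}$; one has $a>0$ and $2a\in\mathbb{Z}$. -}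

module Defs where

open import Data.Nat as ℕ using (ℕ; zero; suc)
import Data.Nat.Divisibility as ℕD
open import Data.Integer as ℤ using (ℤ; +_; +[1+_]; -[1+_])
open import Data.Rational as ℚ using (ℚ; mkℚ; 0ℚ; 1ℚ; _÷_)
open import Data.Product using (Σ; _×_; _,_; ∃)
open import Data.Sum using (_⊎_)
open import Relation.Binary.PropositionalEquality using (_≡_)

SquareFree : ℕ → Set
SquareFree d = ∀ m → (m ℕ.* m) ℕD.∣ d → m ≡ 1

ℕ→ℚ : ℕ → ℚ
ℕ→ℚ n = (+ n) ℚ./ 1

ℤ→ℚ : ℤ → ℚ
ℤ→ℚ z = z ℚ./ 1

IsInt : ℚ → Set
IsInt q = ∃ λ (z : ℤ) → q ≡ ℤ→ℚ z

-- Elements of Q(√d): the pair (x , y) stands for x + y√d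
QD : Set
QD = ℚ × ℚ

re : QD → ℚ
re (x , _) = x

im : QD → ℚ
im (_ , y) = y

one : QD
one = (1ℚ , 0ℚ)

neg : QD → QD
neg (x , y) = (ℚ.- x , ℚ.- y)

mul : ℕ → QD → QD → QD
mul d (x , y) (u , v) = (x ℚ.* u ℚ.+ ℕ→ℚ d ℚ.* y ℚ.* v , x ℚ.* v ℚ.+ y ℚ.* u)

pow : ℕ → QD → ℕ → QD
pow d α zero = one
pow d α (suc n) = mul d α (pow d α n)

trace : QD → ℚ
trace (x , y) = x ℚ.+ x

norm : ℕ → QD → ℚ
norm d (x , y) = x ℚ.* x ℚ.- ℕ→ℚ d ℚ.* y ℚ.* y

-- α lies in the ring of integers O of Q(√d): α is an algebraic integer,
-- i.e. its characteristic polynomial X² - Tr(α) X + N(α) has integer coefficients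
InO : ℕ → QD → Set
InO d α = IsInt (trace α) × IsInt (norm d α)

IsUnit : ℕ → QD → Set
IsUnit d α = InO d α × Σ QD (λ β → InO d β × mul d α β ≡ one)

-- x + y√d > 0 as a real number (with √d the positive square root, d > 0)
RealPos : ℕ → QD → Set
RealPos d (x , y) =
  (0ℚ ℚ.≤ x × 0ℚ ℚ.≤ y × (0ℚ ℚ.< x ⊎ 0ℚ ℚ.< y))
  ⊎ (0ℚ ℚ.< x × y ℚ.< 0ℚ × ℕ→ℚ d ℚ.* y ℚ.* y ℚ.< x ℚ.* x)
  ⊎ (x ℚ.< 0ℚ × 0ℚ ℚ.< y × x ℚ.* x ℚ.< ℕ→ℚ d ℚ.* y ℚ.* y)

GreaterOne : ℕ → QD → Set
GreaterOne d (x , y) = RealPos d (x ℚ.- 1ℚ , y)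

-- u = ± ε^l for some l ∈ ℤ; for l = -n < 0 this means u · ε^n = ± 1
IsPmIntPower : ℕ → QD → QD → Set
IsPmIntPower d ε u = ∃ λ (n : ℕ) →
  (u ≡ pow d ε n ⊎ u ≡ neg (pow d ε n))
  ⊎ (mul d u (pow d ε n) ≡ one ⊎ mul d u (pow d ε n) ≡ neg one)

IsFundamentalUnit : ℕ → QD → Set
IsFundamentalUnit d ε =
  IsUnit d ε × GreaterOne d ε × (∀ u → IsUnit d u → IsPmIntPower d ε u)

-- rational division, with the (irrelevant here) convention p / 0 = 0
divℚ : ℚ → ℚ → ℚ
divℚ p q@(mkℚ +[1+ n ] _ _) = p ÷ q
divℚ p q@(mkℚ -[1+ n ] _ _) = p ÷ q
divℚ p (mkℚ (+ zero) _ _) = 0ℚ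

aₙ : ℕ → QD → ℕ → ℚ
aₙ d ε n = re (pow d ε n)

bₙ : ℕ → QD → ℕ → ℚ
bₙ d ε n = im (pow d ε n)

L : ℕ → QD → ℕ → ℚ
L d ε n = divℚ (aₙ d ε n) (re ε)

{-# OPTIONS --safe #-}
-- Let ε = a + b√d have trace t = 2a ∈ ℤ and norm n = ±1. The real parts a_i of ε^i satisfy
-- a_{i+2} = t a_{i+1} − n a_i; eliminating every other term (n² = 1) gives
-- x_{j+2} = c x_{j+1} − x_j with c = t² − 2n ∈ ℤ for both (a_{2j+1}) and (a_{2j}).
-- So a_{2j+1} is a times an integer sequence starting 1, c − n; a_{2j} is an integer sequence
-- starting 1, t a − n when a ∈ ℤ; and 2 a_{2j} is the integer sequence starting 2, c.
-- These are positive because ε > 1 with n = ±1 forces a > 0 and b ≥ 0. Modulo a divisor M of t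
-- the sequences are geometric, so a common divisor of M and a term divides the first term 1, resp. 2.
module Submission where

open import Defs
open import Data.Nat as ℕ using (ℕ; zero; suc; z<s)
import Data.Nat.Properties as ℕP
import Data.Nat.Divisibility as ℕD
open import Data.Nat.GCD using (gcd; gcd[m,n]∣m; gcd[m,n]∣n)
open import Data.Nat.Primality using (irreducible[2])
import Data.Nat.Coprimality as Coprime
open import Data.Integer as ℤ using (ℤ; ∣_∣; +_; +[1+_]; -[1+_]; 1ℤ; -1ℤ)
import Data.Integer.Properties as ℤP
open import Data.Integer.Divisibility as ℤD using ()
open import Data.Integer.Divisibility.Signed
  using (_∣_; ∣-refl; ∣-trans; ∣ᵤ⇒∣; ∣⇒∣ᵤ; ∣m∣n⇒∣m+n; ∣m∣n⇒∣m-n; ∣m⇒∣m*n; ∣n⇒∣m*n)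
import Data.Integer.Solver as ℤSolver
open import Data.Rational as ℚ using (ℚ; mkℚ; 0ℚ; 1ℚ)
import Data.Rational.Properties as ℚP
import Data.Rational.Unnormalised as ℚᵘ
import Data.Rational.Unnormalised.Properties as ℚᵘP
import Data.Rational.Solver as ℚSolver
open import Data.Product using (_×_; ∃; _,_; proj₁; proj₂)
open import Data.Sum using (_⊎_; inj₁; inj₂)
open import Data.Empty using (⊥-elim)
open import Relation.Nullary using (¬_)
open import Relation.Nullary.Decidable using (toWitness)
open import Relation.Binary.PropositionalEquality

linearRec : ℤ → ℤ → ℤ → ℕ → ℤ
linearRec c x₀ x₁ zero          = x₀
linearRec c x₀ x₁ (suc zero)    = x₁
linearRec c x₀ x₁ (suc (suc k)) = c ℤ.* linearRec c x₀ x₁ (suc k) ℤ.- linearRec c x₀ x₁ k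

module _ {c x₀ x₁ σ M : ℤ} (σ*σ≡1 : σ ℤ.* σ ≡ 1ℤ)
         (M∣c-2σ : M ∣ c ℤ.- (σ ℤ.+ σ)) (M∣x₁-σx₀ : M ∣ x₁ ℤ.- σ ℤ.* x₀) where

  open import Data.Integer using (_+_; _*_; _-_)
  open ℤSolver.+-*-Solver
  open ≡-Reasoning

  private
    x : ℕ → ℤ
    x = linearRec c x₀ x₁

    σ*[σ*y]≡y : ∀ y → σ * (σ * y) ≡ y
    σ*[σ*y]≡y y = begin
      σ * (σ * y) ≡⟨ ℤP.*-assoc σ σ y ⟨
      σ * σ * y   ≡⟨ cong (_* y) σ*σ≡1 ⟩
      1ℤ * y      ≡⟨ ℤP.*-identityˡ y ⟩
      y           ∎

  -- Modulo M the characteristic polynomial X² − c X + 1 is (X − σ)², so x is geometric of ratio σ.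
  linearRec-geometric-mod : ∀ k → M ∣ x (suc k) - σ * x k
  linearRec-geometric-mod zero    = M∣x₁-σx₀
  linearRec-geometric-mod (suc k) =
    subst (M ∣_) step (∣m∣n⇒∣m+n (∣m⇒∣m*n (x (suc k)) M∣c-2σ) (∣n⇒∣m*n σ (linearRec-geometric-mod k)))
    where
    step : (c - (σ + σ)) * x (suc k) + σ * (x (suc k) - σ * x k) ≡ x (suc (suc k)) - σ * x (suc k)
    step = begin
      (c - (σ + σ)) * x (suc k) + σ * (x (suc k) - σ * x k)
        ≡⟨ solve 4 (λ c σ y₁ y₀ → (c :- (σ :+ σ)) :* y₁ :+ σ :* (y₁ :- σ :* y₀)
                                 := c :* y₁ :- σ :* (σ :* y₀) :- σ :* y₁) refl c σ (x (suc k)) (x k) ⟩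
      c * x (suc k) - σ * (σ * x k) - σ * x (suc k)
        ≡⟨ cong (λ y → c * x (suc k) - y - σ * x (suc k)) (σ*[σ*y]≡y (x k)) ⟩
      c * x (suc k) - x k - σ * x (suc k) ∎

  common∣linearRec⇒∣x₀ : ∀ k {g} → g ∣ M → g ∣ x k → g ∣ x₀
  common∣linearRec⇒∣x₀ zero          _   g∣x = g∣x
  common∣linearRec⇒∣x₀ (suc k) {g} g∣M g∣x =
    common∣linearRec⇒∣x₀ k g∣M (subst (g ∣_) (σ*[σ*y]≡y (x k)) (∣n⇒∣m*n σ g∣σx))
    where
    g∣σx : g ∣ σ * x k
    g∣σx = subst (g ∣_) (solve 2 (λ y₁ z → y₁ :- (y₁ :- z) := z) refl (x (suc k)) (σ * x k))
             (∣m∣n⇒∣m-n g∣x (∣-trans g∣M (linearRec-geometric-mod k)))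

m*n≡1⇒m≡±1 : ∀ m n → m ℤ.* n ≡ 1ℤ → m ≡ 1ℤ ⊎ m ≡ -1ℤ
m*n≡1⇒m≡±1 m n mn≡1 =
  ∣m∣≡1⇒m≡±1 m (ℕP.m*n≡1⇒m≡1 ∣ m ∣ ∣ n ∣ (trans (sym (ℤP.abs-* m n)) (cong ∣_∣ mn≡1)))
  where
  ∣m∣≡1⇒m≡±1 : ∀ m → ∣ m ∣ ≡ 1 → m ≡ 1ℤ ⊎ m ≡ -1ℤ
  ∣m∣≡1⇒m≡±1 (+ .1)    refl = inj₁ refl
  ∣m∣≡1⇒m≡±1 -[1+ .0 ] refl = inj₂ refl

±1*±1≡1 : ∀ {n} → n ≡ 1ℤ ⊎ n ≡ -1ℤ → n ℤ.* n ≡ 1ℤ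
±1*±1≡1 (inj₁ refl) = refl
±1*±1≡1 (inj₂ refl) = refl

neg-±1 : ∀ {n} → n ≡ 1ℤ ⊎ n ≡ -1ℤ → ℤ.- n ≡ 1ℤ ⊎ ℤ.- n ≡ -1ℤ
neg-±1 (inj₁ refl) = inj₂ refl
neg-±1 (inj₂ refl) = inj₁ refl

common∣⇒gcd∣ : ∀ {y z w} → (∀ {g} → g ∣ y → g ∣ z → g ∣ w) → gcd ∣ y ∣ ∣ z ∣ ℕD.∣ ∣ w ∣
common∣⇒gcd∣ {y} {z} common =
  ∣⇒∣ᵤ (common {+ gcd ∣ y ∣ ∣ z ∣} (∣ᵤ⇒∣ (gcd[m,n]∣m ∣ y ∣ ∣ z ∣)) (∣ᵤ⇒∣ (gcd[m,n]∣n ∣ y ∣ ∣ z ∣)))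

∣2⇒∣odd⇒≡1 : ∀ {g m} → g ℕD.∣ 2 → g ℕD.∣ m → ¬ 2 ℕD.∣ m → g ≡ 1
∣2⇒∣odd⇒≡1 g∣2 g∣m 2∤m with irreducible[2] g∣2
... | inj₁ g≡1 = g≡1
... | inj₂ refl = ⊥-elim (2∤m g∣m)

module _ where
  open import Data.Rational using (_+_; _-_; _*_; -_; _<_; _≤_)

  ℤ→ℚ≡mkℚ : ∀ z → ℤ→ℚ z ≡ mkℚ z 0 (Coprime.sym (Coprime.1-coprimeTo _))
  ℤ→ℚ≡mkℚ z = ℚP.↥p/↧p≡p (mkℚ z 0 (Coprime.sym (Coprime.1-coprimeTo _)))

  ℤ→ℚ-injective : ∀ {x y} → ℤ→ℚ x ≡ ℤ→ℚ y → x ≡ y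
  ℤ→ℚ-injective {x} {y} eq = cong ℚ.numerator (trans (sym (ℤ→ℚ≡mkℚ x)) (trans eq (ℤ→ℚ≡mkℚ y)))

  ℤ→ℚ-homo-+ : ∀ x y → ℤ→ℚ (x ℤ.+ y) ≡ ℤ→ℚ x + ℤ→ℚ y
  ℤ→ℚ-homo-+ x y rewrite ℤ→ℚ≡mkℚ x | ℤ→ℚ≡mkℚ y =
    cong (ℚ._/ 1) (sym (cong₂ ℤ._+_ (ℤP.*-identityʳ x) (ℤP.*-identityʳ y)))

  ℤ→ℚ-homo-* : ∀ x y → ℤ→ℚ (x ℤ.* y) ≡ ℤ→ℚ x * ℤ→ℚ y
  ℤ→ℚ-homo-* x y rewrite ℤ→ℚ≡mkℚ x | ℤ→ℚ≡mkℚ y = refl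

  ℤ→ℚ-homo‿- : ∀ x → ℤ→ℚ (ℤ.- x) ≡ - ℤ→ℚ x
  ℤ→ℚ-homo‿- x rewrite ℤ→ℚ≡mkℚ x | ℤ→ℚ≡mkℚ (ℤ.- x) = neg-mkℚ x
    where
    neg-mkℚ : ∀ x → mkℚ (ℤ.- x) 0 (Coprime.sym (Coprime.1-coprimeTo _))
                    ≡ - mkℚ x 0 (Coprime.sym (Coprime.1-coprimeTo _))
    neg-mkℚ (+ zero) = refl
    neg-mkℚ +[1+ n ] = refl
    neg-mkℚ -[1+ n ] = refl

  ℤ→ℚ-homo-- : ∀ x y → ℤ→ℚ (x ℤ.- y) ≡ ℤ→ℚ x - ℤ→ℚ y
  ℤ→ℚ-homo-- x y = trans (ℤ→ℚ-homo-+ x (ℤ.- y)) (cong (_+_ (ℤ→ℚ x)) (ℤ→ℚ-homo‿- y))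

  ℤ→ℚ>0⇒natural : ∀ z → 0ℚ < ℤ→ℚ z → 0 ℕ.< ∣ z ∣ × ℤ→ℚ z ≡ ℕ→ℚ ∣ z ∣
  ℤ→ℚ>0⇒natural +[1+ n ] _   = z<s , refl
  ℤ→ℚ>0⇒natural (+ zero) 0<0 = ⊥-elim (ℚP.<-irrefl refl 0<0)
  ℤ→ℚ>0⇒natural -[1+ n ] 0<z with subst (0ℚ <_) (ℤ→ℚ≡mkℚ -[1+ n ]) 0<z
  ... | ℚ.*<* ()

  z/2+z/2≡z : ∀ z → z ℚ./ 2 + z ℚ./ 2 ≡ ℤ→ℚ z
  z/2+z/2≡z z = ℚP.toℚᵘ-injective (begin
      ℚ.toℚᵘ (z ℚ./ 2 + z ℚ./ 2)              ≈⟨ ℚP.toℚᵘ-homo-+ (z ℚ./ 2) (z ℚ./ 2) ⟩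
      ℚ.toℚᵘ (z ℚ./ 2) ℚᵘ.+ ℚ.toℚᵘ (z ℚ./ 2)  ≈⟨ ℚᵘP.+-cong (ℚP.toℚᵘ-fromℚᵘ z/2) (ℚP.toℚᵘ-fromℚᵘ z/2) ⟩
      z/2 ℚᵘ.+ z/2                             ≈⟨ ℚᵘ.*≡* (solve 1 (λ z → (z :* con (+ 2) :+ z :* con (+ 2)) :* con (+ 1)
                                                                       := z :* (con (+ 2) :* con (+ 2))) refl z) ⟩
      ℚᵘ.mkℚᵘ z 0                              ≈⟨ ℚP.toℚᵘ-fromℚᵘ (ℚᵘ.mkℚᵘ z 0) ⟨
      ℚ.toℚᵘ (ℤ→ℚ z)                           ∎)
    where
    open ℚᵘP.≃-Reasoning
    open ℤSolver.+-*-Solver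
    z/2 : ℚᵘ.ℚᵘ
    z/2 = ℚᵘ.mkℚᵘ z 1

  q*[x/q]≡x : ∀ x {q} → 0ℚ < q → q * divℚ x q ≡ x
  q*[x/q]≡x x {q@(mkℚ +[1+ _ ] _ _)} _ = begin
      q * (x * ℚ.1/ q) ≡⟨ cong (q *_) (ℚP.*-comm x (ℚ.1/ q)) ⟩
      q * (ℚ.1/ q * x) ≡⟨ ℚP.*-assoc q (ℚ.1/ q) x ⟨
      q * ℚ.1/ q * x   ≡⟨ cong (_* x) (ℚP.*-inverseʳ q) ⟩
      1ℚ * x           ≡⟨ ℚP.*-identityˡ x ⟩
      x                ∎
    where open ≡-Reasoning
  q*[x/q]≡x x {mkℚ (+ zero) _ _} (ℚ.*<* (ℤ.+<+ ()))
  q*[x/q]≡x x {mkℚ -[1+ _ ] _ _} (ℚ.*<* ())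

  q*x/q≡x : ∀ x {q} → 0ℚ < q → divℚ (q * x) q ≡ x
  q*x/q≡x x {q@(mkℚ +[1+ _ ] _ _)} _ = begin
      q * x * ℚ.1/ q   ≡⟨ cong (_* ℚ.1/ q) (ℚP.*-comm q x) ⟩
      x * q * ℚ.1/ q   ≡⟨ ℚP.*-assoc x q (ℚ.1/ q) ⟩
      x * (q * ℚ.1/ q) ≡⟨ cong (x *_) (ℚP.*-inverseʳ q) ⟩
      x * 1ℚ           ≡⟨ ℚP.*-identityʳ x ⟩
      x                ∎
    where open ≡-Reasoning
  q*x/q≡x x {mkℚ (+ zero) _ _} (ℚ.*<* (ℤ.+<+ ()))
  q*x/q≡x x {mkℚ -[1+ _ ] _ _} (ℚ.*<* ())

  p<q⇒0<q-p : ∀ {p q} → p < q → 0ℚ < q - p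
  p<q⇒0<q-p {p} {q} p<q = subst (_< q - p) (ℚP.+-inverseʳ p) (ℚP.+-monoˡ-< (- p) p<q)

  pos*pos : ∀ {p q} → 0ℚ < p → 0ℚ < q → 0ℚ < p * q
  pos*pos {p} {q} p>0 q>0 =
    ℚP.positive⁻¹ _ {{ℚP.pos*pos⇒pos p {{ℚ.positive p>0}} q {{ℚ.positive q>0}}}}

  nonNeg*nonNeg : ∀ {p q} → 0ℚ ≤ p → 0ℚ ≤ q → 0ℚ ≤ p * q
  nonNeg*nonNeg {p} {q} p≥0 q≥0 =
    ℚP.nonNegative⁻¹ _ {{ℚP.nonNeg*nonNeg⇒nonNeg p {{ℚ.nonNegative p≥0}} q {{ℚ.nonNegative q≥0}}}}

  pos*q>0⇒q>0 : ∀ {p q} → 0ℚ < p → 0ℚ < p * q → 0ℚ < q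
  pos*q>0⇒q>0 {p} {q} p>0 pq>0 =
    ℚP.*-cancelˡ-<-nonNeg p {{ℚ.nonNegative (ℚP.<⇒≤ p>0)}} (subst (_< p * q) (sym (ℚP.*-zeroʳ p)) pq>0)

  p+p>0⇒p>0 : ∀ {p} → 0ℚ < p + p → 0ℚ < p
  p+p>0⇒p>0 {p} 2p>0 = subst (0ℚ <_) (solve 1 (λ p → con ℚ.½ :* (p :+ p) := p) refl p)
                          (pos*pos (toWitness {a? = 0ℚ ℚ.<? ℚ.½} _) 2p>0)
    where open ℚSolver.+-*-Solver

  ℤ→ℚ-±1-bounds : ∀ {n} → n ≡ 1ℤ ⊎ n ≡ -1ℤ → ℤ→ℚ n ≤ 1ℚ × - 1ℚ ≤ ℤ→ℚ n
  ℤ→ℚ-±1-bounds (inj₁ refl) = toWitness {a? = 1ℚ ℚ.≤? 1ℚ} _ , toWitness {a? = - 1ℚ ℚ.≤? 1ℚ} _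
  ℤ→ℚ-±1-bounds (inj₂ refl) = toWitness {a? = - 1ℚ ℚ.≤? 1ℚ} _ , toWitness {a? = - 1ℚ ℚ.≤? - 1ℚ} _

  ℕ→ℚ-nonNeg : ∀ d → 0ℚ ≤ ℕ→ℚ d
  ℕ→ℚ-nonNeg d = ℚP.nonNegative⁻¹ _ {{ℚP.normalize-nonNeg d 1}}

  linearRec-unique : ∀ {c x₀ x₁} (R : ℕ → ℚ) s →
    (∀ j → R (suc (suc j)) ≡ ℤ→ℚ c * R (suc j) - R j) →
    R 0 ≡ s * ℤ→ℚ x₀ → R 1 ≡ s * ℤ→ℚ x₁ →
    ∀ j → R j ≡ s * ℤ→ℚ (linearRec c x₀ x₁ j)
  linearRec-unique R s rec R₀ R₁ zero          = R₀
  linearRec-unique R s rec R₀ R₁ (suc zero)    = R₁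
  linearRec-unique {c} {x₀} {x₁} R s rec R₀ R₁ (suc (suc j)) = begin
    R (suc (suc j))                       ≡⟨ rec j ⟩
    ℤ→ℚ c * R (suc j) - R j               ≡⟨ cong₂ (λ u v → ℤ→ℚ c * u - v)
                                               (linearRec-unique R s rec R₀ R₁ (suc j))
                                               (linearRec-unique R s rec R₀ R₁ j) ⟩
    ℤ→ℚ c * (s * ℤ→ℚ y₁) - s * ℤ→ℚ y₀    ≡⟨ solve 4 (λ c s u v → c :* (s :* u) :- s :* v := s :* (c :* u :- v))
                                               refl (ℤ→ℚ c) s (ℤ→ℚ y₁) (ℤ→ℚ y₀) ⟩
    s * (ℤ→ℚ c * ℤ→ℚ y₁ - ℤ→ℚ y₀)        ≡⟨ cong (λ u → s * (u - ℤ→ℚ y₀)) (ℤ→ℚ-homo-* c y₁) ⟨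
    s * (ℤ→ℚ (c ℤ.* y₁) - ℤ→ℚ y₀)        ≡⟨ cong (s *_) (ℤ→ℚ-homo-- (c ℤ.* y₁) y₀) ⟨
    s * ℤ→ℚ (c ℤ.* y₁ ℤ.- y₀)             ∎
    where
    open ≡-Reasoning
    open ℚSolver.+-*-Solver
    y₀ y₁ : ℤ
    y₀ = linearRec c x₀ x₁ j
    y₁ = linearRec c x₀ x₁ (suc j)

  norm-mul : ∀ d α β → norm d (mul d α β) ≡ norm d α * norm d β
  norm-mul d (x , y) (u , v) = solve 5 (λ D x y u v →
      (x :* u :+ D :* y :* v) :* (x :* u :+ D :* y :* v) :- D :* (x :* v :+ y :* u) :* (x :* v :+ y :* u)
      := (x :* x :- D :* y :* y) :* (u :* u :- D :* v :* v)) refl (ℕ→ℚ d) x y u v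
    where open ℚSolver.+-*-Solver

  norm-one : ∀ d → norm d one ≡ 1ℚ
  norm-one d = solve 1 (λ D → con 1ℚ :* con 1ℚ :- D :* con 0ℚ :* con 0ℚ := con 1ℚ) refl (ℕ→ℚ d)
    where open ℚSolver.+-*-Solver

  unit⇒norm≡±1 : ∀ d α → IsUnit d α → ∃ λ n → norm d α ≡ ℤ→ℚ n × (n ≡ 1ℤ ⊎ n ≡ -1ℤ)
  unit⇒norm≡±1 d α ((_ , n , Nα≡n) , β , (_ , n′ , Nβ≡n′) , αβ≡1) =
    n , Nα≡n , m*n≡1⇒m≡±1 n n′ (ℤ→ℚ-injective (begin
      ℤ→ℚ (n ℤ.* n′)        ≡⟨ ℤ→ℚ-homo-* n n′ ⟩
      ℤ→ℚ n * ℤ→ℚ n′        ≡⟨ cong₂ _*_ Nα≡n Nβ≡n′ ⟨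
      norm d α * norm d β   ≡⟨ norm-mul d α β ⟨
      norm d (mul d α β)    ≡⟨ cong (norm d) αβ≡1 ⟩
      norm d one            ≡⟨ norm-one d ⟩
      1ℚ                    ∎))
    where open ≡-Reasoning

  -- With x = a − 1: N = 1 + 2x + (x² − d b²) and 2a = (1 + N) + (d b² − x²).
  greaterOne⇒re>0∧im≥0 : ∀ d a b → norm d (a , b) ≤ 1ℚ → - 1ℚ ≤ norm d (a , b) →
                           GreaterOne d (a , b) → 0ℚ < a × 0ℚ ≤ b
  greaterOne⇒re>0∧im≥0 d a b _ _ (inj₁ (a-1≥0 , b≥0 , _)) =
    subst (0ℚ <_) (solve 1 (λ a → a :- con 1ℚ :+ con 1ℚ := a) refl a)
      (ℚP.+-mono-≤-< a-1≥0 (toWitness {a? = 0ℚ ℚ.<? 1ℚ} _)) , b≥0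
    where open ℚSolver.+-*-Solver
  greaterOne⇒re>0∧im≥0 d a b N≤1 _ (inj₂ (inj₁ (a-1>0 , _ , Dbb<[a-1]²))) =
    ⊥-elim (ℚP.<-irrefl refl (ℚP.<-≤-trans 1<N N≤1))
    where
    open ℚSolver.+-*-Solver
    1<N : 1ℚ < norm d (a , b)
    1<N = subst (1ℚ <_) (solve 3 (λ a D b → con 1ℚ :+ ((a :- con 1ℚ) :+ (a :- con 1ℚ))
                                      :+ ((a :- con 1ℚ) :* (a :- con 1ℚ) :- D :* b :* b)
                                      := a :* a :- D :* b :* b) refl a (ℕ→ℚ d) b)
            (ℚP.+-mono-< (ℚP.+-monoʳ-< 1ℚ (ℚP.+-mono-< a-1>0 a-1>0)) (p<q⇒0<q-p Dbb<[a-1]²))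
  greaterOne⇒re>0∧im≥0 d a b _ -1≤N (inj₂ (inj₂ (_ , b>0 , [a-1]²<Dbb))) =
    p+p>0⇒p>0 2a>0 , ℚP.<⇒≤ b>0
    where
    open ℚSolver.+-*-Solver
    2a>0 : 0ℚ < a + a
    2a>0 = subst (0ℚ <_) (solve 3 (λ a D b → (con 1ℚ :+ (a :* a :- D :* b :* b))
                                      :+ (D :* b :* b :- (a :- con 1ℚ) :* (a :- con 1ℚ))
                                      := a :+ a) refl a (ℕ→ℚ d) b)
             (ℚP.+-mono-≤-< (ℚP.+-monoʳ-≤ 1ℚ -1≤N) (p<q⇒0<q-p [a-1]²<Dbb))

module _ (d : ℕ) (ε : QD) where
  open import Data.Rational using (_-_; _*_; _<_; _≤_)
  open ℚSolver.+-*-Solver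

  private
    A : ℕ → ℚ
    A = aₙ d ε
    T N : ℚ
    T = trace ε
    N = norm d ε

  aₙ-recurrence : ∀ i → A (suc (suc i)) ≡ T * A (suc i) - N * A i
  aₙ-recurrence i = solve 5 (λ a D b x y →
      a :* (a :* x :+ D :* b :* y) :+ D :* b :* (a :* y :+ b :* x)
      := (a :+ a) :* (a :* x :+ D :* b :* y) :- (a :* a :- D :* b :* b) :* x)
    refl (re ε) (ℕ→ℚ d) (im ε) (A i) (bₙ d ε i)

  aₙ-one : A 1 ≡ re ε
  aₙ-one = solve 3 (λ a D b → a :* con 1ℚ :+ D :* b :* con 0ℚ := a) refl (re ε) (ℕ→ℚ d) (im ε)

  aₙ-two : A 2 ≡ T * re ε - N
  aₙ-two = begin
    A 2                  ≡⟨ aₙ-recurrence 0 ⟩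
    T * A 1 - N * 1ℚ     ≡⟨ cong (λ x → T * x - N * 1ℚ) aₙ-one ⟩
    T * re ε - N * 1ℚ    ≡⟨ cong (T * re ε -_) (ℚP.*-identityʳ N) ⟩
    T * re ε - N         ∎
    where open ≡-Reasoning

  aₙ-three : A 3 ≡ re ε * (T * T - N - N - N)
  aₙ-three = begin
    A 3                          ≡⟨ aₙ-recurrence 1 ⟩
    T * A 2 - N * A 1            ≡⟨ cong₂ (λ x y → T * x - N * y) aₙ-two aₙ-one ⟩
    T * (T * re ε - N) - N * re ε ≡⟨ solve 2 (λ a N → (a :+ a) :* ((a :+ a) :* a :- N) :- N :* a
                                              := a :* ((a :+ a) :* (a :+ a) :- N :- N :- N)) refl (re ε) N ⟩
    re ε * (T * T - N - N - N)   ∎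
    where open ≡-Reasoning

  aₙ-recurrence₂ : N * N ≡ 1ℚ → ∀ i → A (4 ℕ.+ i) ≡ (T * T - N - N) * A (2 ℕ.+ i) - A i
  aₙ-recurrence₂ N²≡1 i = begin
    A (4 ℕ.+ i)
      ≡⟨ aₙ-recurrence (2 ℕ.+ i) ⟩
    T * A (3 ℕ.+ i) - N * A (2 ℕ.+ i)
      ≡⟨ cong (λ x → T * x - N * A (2 ℕ.+ i)) (aₙ-recurrence (1 ℕ.+ i)) ⟩
    T * (T * A (2 ℕ.+ i) - N * A (1 ℕ.+ i)) - N * A (2 ℕ.+ i)
      ≡⟨ solve 5 (λ T N x₂ x₁ x₀ → T :* (T :* x₂ :- N :* x₁) :- N :* x₂
                   := (T :* T :- N :- N) :* x₂ :- N :* (T :* x₁ :- N :* x₀ :- x₂) :- N :* N :* x₀)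
           refl T N (A (2 ℕ.+ i)) (A (1 ℕ.+ i)) (A i) ⟩
    (T * T - N - N) * A (2 ℕ.+ i) - N * (T * A (1 ℕ.+ i) - N * A i - A (2 ℕ.+ i)) - N * N * A i
      ≡⟨ cong₂ (λ x y → (T * T - N - N) * A (2 ℕ.+ i) - N * (x - A (2 ℕ.+ i)) - y * A i)
           (sym (aₙ-recurrence i)) N²≡1 ⟩
    (T * T - N - N) * A (2 ℕ.+ i) - N * (A (2 ℕ.+ i) - A (2 ℕ.+ i)) - 1ℚ * A i
      ≡⟨ solve 4 (λ C N x₂ x₀ → C :* x₂ :- N :* (x₂ :- x₂) :- con 1ℚ :* x₀ := C :* x₂ :- x₀)
           refl (T * T - N - N) N (A (2 ℕ.+ i)) (A i) ⟩
    (T * T - N - N) * A (2 ℕ.+ i) - A i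
      ∎
    where open ≡-Reasoning

  aₙ-bₙ-pos : 0ℚ < re ε → 0ℚ ≤ im ε → ∀ i → 0ℚ < A i × 0ℚ ≤ bₙ d ε i
  aₙ-bₙ-pos a>0 b≥0 zero = toWitness {a? = 0ℚ ℚ.<? 1ℚ} _ , toWitness {a? = 0ℚ ℚ.≤? 0ℚ} _
  aₙ-bₙ-pos a>0 b≥0 (suc i) with aₙ-bₙ-pos a>0 b≥0 i
  ... | x>0 , y≥0 = ℚP.+-mono-<-≤ (pos*pos a>0 x>0) (nonNeg*nonNeg (nonNeg*nonNeg (ℕ→ℚ-nonNeg d) b≥0) y≥0)
                  , ℚP.+-mono-≤ (nonNeg*nonNeg (ℚP.<⇒≤ a>0) y≥0) (nonNeg*nonNeg b≥0 (ℚP.<⇒≤ x>0))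

module UnitGreaterOne (d : ℕ) (a b : ℚ) (t n : ℤ)
  (T≡t : trace (a , b) ≡ ℤ→ℚ t) (N≡n : norm d (a , b) ≡ ℤ→ℚ n) (n≡±1 : n ≡ 1ℤ ⊎ n ≡ -1ℤ)
  (ε>1 : GreaterOne d (a , b)) where

  open import Data.Rational using (_+_; _-_; _*_; -_; _<_; _≤_)

  private
    ε : QD
    ε = (a , b)

    T N : ℚ
    T = trace ε
    N = norm d ε

    c σ : ℤ
    c = t ℤ.* t ℤ.- n ℤ.- n
    σ = ℤ.- n

    σ*σ≡1 : σ ℤ.* σ ≡ 1ℤ
    σ*σ≡1 = ±1*±1≡1 (neg-±1 n≡±1)

    N*N≡1 : N * N ≡ 1ℚ
    N*N≡1 = begin
      N * N              ≡⟨ cong₂ _*_ N≡n N≡n ⟩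
      ℤ→ℚ n * ℤ→ℚ n      ≡⟨ ℤ→ℚ-homo-* n n ⟨
      ℤ→ℚ (n ℤ.* n)      ≡⟨ cong ℤ→ℚ (±1*±1≡1 n≡±1) ⟩
      1ℚ                 ∎
      where open ≡-Reasoning

    a>0∧b≥0 : 0ℚ < a × 0ℚ ≤ b
    a>0∧b≥0 = greaterOne⇒re>0∧im≥0 d a b
      (subst (_≤ 1ℚ) (sym N≡n) (proj₁ (ℤ→ℚ-±1-bounds n≡±1)))
      (subst (- 1ℚ ≤_) (sym N≡n) (proj₂ (ℤ→ℚ-±1-bounds n≡±1))) ε>1

    a>0 : 0ℚ < a
    a>0 = proj₁ a>0∧b≥0

    aₙ-pos : ∀ i → 0ℚ < aₙ d ε i
    aₙ-pos i = proj₁ (aₙ-bₙ-pos d ε a>0 (proj₂ a>0∧b≥0) i)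

    ℤ→ℚ-c : ℤ→ℚ c ≡ T * T - N - N
    ℤ→ℚ-c = begin
      ℤ→ℚ (t ℤ.* t ℤ.- n ℤ.- n)          ≡⟨ ℤ→ℚ-homo-- (t ℤ.* t ℤ.- n) n ⟩
      ℤ→ℚ (t ℤ.* t ℤ.- n) - ℤ→ℚ n        ≡⟨ cong (_- ℤ→ℚ n) (ℤ→ℚ-homo-- (t ℤ.* t) n) ⟩
      ℤ→ℚ (t ℤ.* t) - ℤ→ℚ n - ℤ→ℚ n      ≡⟨ cong (λ x → x - ℤ→ℚ n - ℤ→ℚ n) (ℤ→ℚ-homo-* t t) ⟩
      ℤ→ℚ t * ℤ→ℚ t - ℤ→ℚ n - ℤ→ℚ n      ≡⟨ cong₂ (λ x y → x * x - y - y) T≡t N≡n ⟨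
      T * T - N - N                       ∎
      where open ≡-Reasoning

    aₙ-subsequence : ∀ r s x₀ x₁ → aₙ d ε r ≡ s * ℤ→ℚ x₀ → aₙ d ε (2 ℕ.+ r) ≡ s * ℤ→ℚ x₁ →
                     ∀ j → aₙ d ε (2 ℕ.* j ℕ.+ r) ≡ s * ℤ→ℚ (linearRec c x₀ x₁ j)
    aₙ-subsequence r s x₀ x₁ = linearRec-unique (λ j → aₙ d ε (2 ℕ.* j ℕ.+ r)) s step
      where
      open ≡-Reasoning
      step : ∀ j → aₙ d ε (2 ℕ.* suc (suc j) ℕ.+ r)
                   ≡ ℤ→ℚ c * aₙ d ε (2 ℕ.* suc j ℕ.+ r) - aₙ d ε (2 ℕ.* j ℕ.+ r)
      step j = begin
        aₙ d ε (2 ℕ.* suc (suc j) ℕ.+ r)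
          ≡⟨ cong (λ i → aₙ d ε (i ℕ.+ r)) (trans (ℕP.*-suc 2 (suc j)) (cong (2 ℕ.+_) (ℕP.*-suc 2 j))) ⟩
        aₙ d ε (4 ℕ.+ (2 ℕ.* j ℕ.+ r))
          ≡⟨ aₙ-recurrence₂ d ε N*N≡1 (2 ℕ.* j ℕ.+ r) ⟩
        (T * T - N - N) * aₙ d ε (2 ℕ.+ (2 ℕ.* j ℕ.+ r)) - aₙ d ε (2 ℕ.* j ℕ.+ r)
          ≡⟨ cong₂ (λ x i → x * aₙ d ε (i ℕ.+ r) - aₙ d ε (2 ℕ.* j ℕ.+ r)) ℤ→ℚ-c (ℕP.*-suc 2 j) ⟨
        ℤ→ℚ c * aₙ d ε (2 ℕ.* suc j ℕ.+ r) - aₙ d ε (2 ℕ.* j ℕ.+ r)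
          ∎

    aₙ-evens : ∀ s x₀ x₁ → 1ℚ ≡ s * ℤ→ℚ x₀ → aₙ d ε 2 ≡ s * ℤ→ℚ x₁ →
               ∀ k → aₙ d ε (2 ℕ.* k) ≡ s * ℤ→ℚ (linearRec c x₀ x₁ k)
    aₙ-evens s x₀ x₁ aₙ-zero aₙ-two k =
      trans (cong (aₙ d ε) (sym (ℕP.+-identityʳ (2 ℕ.* k)))) (aₙ-subsequence 0 s x₀ x₁ aₙ-zero aₙ-two k)

    common∣evens⇒∣x₀ : ∀ {M x₀ x₁} → M ∣ t → M ∣ x₁ ℤ.- σ ℤ.* x₀ →
                       ∀ k {g} → g ∣ M → g ∣ linearRec c x₀ x₁ k → g ∣ x₀
    common∣evens⇒∣x₀ {M} M∣t = common∣linearRec⇒∣x₀ {σ = σ} σ*σ≡1 M∣c-2σ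
      where
      open ℤSolver.+-*-Solver
      M∣c-2σ : M ∣ c ℤ.- (σ ℤ.+ σ)
      M∣c-2σ = subst (M ∣_) (solve 2 (λ t n → t :* t := t :* t :- n :- n :- (:- n :+ :- n)) refl t n)
                 (∣m⇒∣m*n t M∣t)

  L-odd-integral : ∀ j → ∃ λ m → 0 ℕ.< m × L d ε (2 ℕ.* suc j ℕ.∸ 1) ≡ ℕ→ℚ m
  L-odd-integral j = ∣ z ∣ , proj₁ z-natural , (begin
      L d ε (2 ℕ.* suc j ℕ.∸ 1)        ≡⟨ cong (λ i → divℚ (aₙ d ε i) a) odd-index ⟩
      divℚ (aₙ d ε (2 ℕ.* j ℕ.+ 1)) a  ≡⟨ cong (λ x → divℚ x a) (aₙ-odds j) ⟩
      divℚ (a * ℤ→ℚ z) a               ≡⟨ q*x/q≡x (ℤ→ℚ z) a>0 ⟩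
      ℤ→ℚ z                            ≡⟨ proj₂ z-natural ⟩
      ℕ→ℚ ∣ z ∣                        ∎)
    where
    open ≡-Reasoning
    aₙ-odds : ∀ i → aₙ d ε (2 ℕ.* i ℕ.+ 1) ≡ a * ℤ→ℚ (linearRec c 1ℤ (c ℤ.- n) i)
    aₙ-odds = aₙ-subsequence 1 a 1ℤ (c ℤ.- n)
      (trans (aₙ-one d ε) (sym (ℚP.*-identityʳ a)))
      (trans (aₙ-three d ε) (cong (a *_) (sym (trans (ℤ→ℚ-homo-- c n) (cong₂ _-_ ℤ→ℚ-c (sym N≡n))))))
    z : ℤ
    z = linearRec c 1ℤ (c ℤ.- n) j
    odd-index : 2 ℕ.* suc j ℕ.∸ 1 ≡ 2 ℕ.* j ℕ.+ 1
    odd-index = trans (cong (ℕ._∸ 1) (ℕP.*-suc 2 j)) (ℕP.+-comm 1 (2 ℕ.* j))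
    z-natural : 0 ℕ.< ∣ z ∣ × ℤ→ℚ z ≡ ℕ→ℚ ∣ z ∣
    z-natural = ℤ→ℚ>0⇒natural z (pos*q>0⇒q>0 a>0 (subst (0ℚ <_) (aₙ-odds j) (aₙ-pos (2 ℕ.* j ℕ.+ 1))))

  aL-even-coprime : ∀ k m → a ≡ ℕ→ℚ m →
    ∃ λ N′ → 0 ℕ.< N′ × a * L d ε (2 ℕ.* k) ≡ ℕ→ℚ N′ × gcd m N′ ≡ 1
  aL-even-coprime k m a≡m = ∣ z ∣ , proj₁ z-natural , trans aL≡z (proj₂ z-natural) , gcd≡1
    where
    open ≡-Reasoning
    x₁ : ℤ
    x₁ = t ℤ.* + m ℤ.- n
    aₙ-two≡x₁ : aₙ d ε 2 ≡ 1ℚ * ℤ→ℚ x₁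
    aₙ-two≡x₁ = begin
      aₙ d ε 2                    ≡⟨ aₙ-two d ε ⟩
      T * a - N                   ≡⟨ cong₂ (λ x y → x * y - N) T≡t a≡m ⟩
      ℤ→ℚ t * ℤ→ℚ (+ m) - N       ≡⟨ cong₂ _-_ (sym (ℤ→ℚ-homo-* t (+ m))) N≡n ⟩
      ℤ→ℚ (t ℤ.* + m) - ℤ→ℚ n     ≡⟨ ℤ→ℚ-homo-- (t ℤ.* + m) n ⟨
      ℤ→ℚ x₁                      ≡⟨ ℚP.*-identityˡ (ℤ→ℚ x₁) ⟨
      1ℚ * ℤ→ℚ x₁                 ∎
    z : ℤ
    z = linearRec c 1ℤ x₁ k
    aₙ-even : aₙ d ε (2 ℕ.* k) ≡ ℤ→ℚ z
    aₙ-even = trans (aₙ-evens 1ℚ 1ℤ x₁ refl aₙ-two≡x₁ k) (ℚP.*-identityˡ (ℤ→ℚ z))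
    aL≡z : a * L d ε (2 ℕ.* k) ≡ ℤ→ℚ z
    aL≡z = trans (q*[x/q]≡x (aₙ d ε (2 ℕ.* k)) a>0) aₙ-even
    z-natural : 0 ℕ.< ∣ z ∣ × ℤ→ℚ z ≡ ℕ→ℚ ∣ z ∣
    z-natural = ℤ→ℚ>0⇒natural z (subst (0ℚ <_) aₙ-even (aₙ-pos (2 ℕ.* k)))
    m∣t : + m ∣ t
    m∣t = subst (+ m ∣_) (ℤ→ℚ-injective (begin
            ℤ→ℚ (+ m ℤ.+ + m)        ≡⟨ ℤ→ℚ-homo-+ (+ m) (+ m) ⟩
            ℤ→ℚ (+ m) + ℤ→ℚ (+ m)    ≡⟨ cong (λ x → x + x) a≡m ⟨
            T                        ≡⟨ T≡t ⟩
            ℤ→ℚ t                    ∎))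
            (∣m∣n⇒∣m+n ∣-refl ∣-refl)
    m∣x₁-σ : + m ∣ x₁ ℤ.- σ ℤ.* 1ℤ
    m∣x₁-σ = subst (+ m ∣_) (solve 3 (λ t m n → t :* m := t :* m :- n :- (:- n) :* con 1ℤ) refl t (+ m) n)
               (∣n⇒∣m*n t ∣-refl)
      where open ℤSolver.+-*-Solver
    gcd≡1 : gcd m ∣ z ∣ ≡ 1
    gcd≡1 = ℕD.∣1⇒≡1 (common∣⇒gcd∣ (common∣evens⇒∣x₀ m∣t m∣x₁-σ k))

  a₀L-even-coprime : ∀ k a₀ → ¬ (+ 2 ℤD.∣ a₀) → a ≡ a₀ ℚ./ 2 →
    ∃ λ N′ → 0 ℕ.< N′ × ℤ→ℚ a₀ * L d ε (2 ℕ.* k) ≡ ℕ→ℚ N′ × gcd ∣ a₀ ∣ N′ ≡ 1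
  a₀L-even-coprime k a₀ a₀-odd a≡a₀/2
    with ℤ→ℚ-injective {a₀} {t} (trans (sym (z/2+z/2≡z a₀)) (trans (cong (λ x → x + x) (sym a≡a₀/2)) T≡t))
  ... | refl = ∣ z ∣ , proj₁ z-natural , trans tL≡z (proj₂ z-natural) , gcd≡1
    where
    open ≡-Reasoning
    z : ℤ
    z = linearRec c (+ 2) c k
    x : ℚ
    x = aₙ d ε (2 ℕ.* k)
    z≡x+x : ℤ→ℚ z ≡ x + x
    z≡x+x = begin
      ℤ→ℚ z                      ≡⟨ solve 1 (λ z → z := con ℚ.½ :* z :+ con ℚ.½ :* z) refl (ℤ→ℚ z) ⟩
      ℚ.½ * ℤ→ℚ z + ℚ.½ * ℤ→ℚ z  ≡⟨ cong (λ y → y + y) (aₙ-evens ℚ.½ (+ 2) c refl aₙ-two≡c/2 k) ⟨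
      x + x                      ∎
      where
      open ℚSolver.+-*-Solver
      aₙ-two≡c/2 : aₙ d ε 2 ≡ ℚ.½ * ℤ→ℚ c
      aₙ-two≡c/2 = begin
        aₙ d ε 2               ≡⟨ aₙ-two d ε ⟩
        T * a - N              ≡⟨ solve 2 (λ a N → (a :+ a) :* a :- N
                                                  := con ℚ.½ :* ((a :+ a) :* (a :+ a) :- N :- N)) refl a N ⟩
        ℚ.½ * (T * T - N - N)  ≡⟨ cong (ℚ.½ *_) ℤ→ℚ-c ⟨
        ℚ.½ * ℤ→ℚ c            ∎
    tL≡z : ℤ→ℚ t * L d ε (2 ℕ.* k) ≡ ℤ→ℚ z
    tL≡z = begin
      ℤ→ℚ t * divℚ x a             ≡⟨ cong (_* divℚ x a) T≡t ⟨
      (a + a) * divℚ x a           ≡⟨ ℚP.*-distribʳ-+ (divℚ x a) a a ⟩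
      a * divℚ x a + a * divℚ x a  ≡⟨ cong (λ y → y + y) (q*[x/q]≡x x a>0) ⟩
      x + x                        ≡⟨ z≡x+x ⟨
      ℤ→ℚ z                        ∎
    z-natural : 0 ℕ.< ∣ z ∣ × ℤ→ℚ z ≡ ℕ→ℚ ∣ z ∣
    z-natural = ℤ→ℚ>0⇒natural z (subst (0ℚ <_) (sym z≡x+x) (ℚP.+-mono-< (aₙ-pos (2 ℕ.* k)) (aₙ-pos (2 ℕ.* k))))
    t∣c-2σ : t ∣ c ℤ.- σ ℤ.* + 2
    t∣c-2σ = subst (t ∣_) (solve 2 (λ t n → t :* t := t :* t :- n :- n :- (:- n) :* con (+ 2)) refl t n)
               (∣m⇒∣m*n t ∣-refl)
      where open ℤSolver.+-*-Solver
    gcd≡1 : gcd ∣ t ∣ ∣ z ∣ ≡ 1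
    gcd≡1 = ∣2⇒∣odd⇒≡1 (common∣⇒gcd∣ (common∣evens⇒∣x₀ ∣-refl t∣c-2σ k)) (gcd[m,n]∣m ∣ t ∣ ∣ z ∣) a₀-odd

open import Data.Nat using (_<_; _≤_; _*_; _∸_)

corollary17 : (d : ℕ) → 1 < d → SquareFree d →
    (ε : QD) → IsFundamentalUnit d ε →
    (k : ℕ) → 1 ≤ k →
      (∃ λ (m : ℕ) → 0 < m × L d ε (2 * k ∸ 1) ≡ ℕ→ℚ m)
      × ((m : ℕ) → 0 < m → re ε ≡ ℕ→ℚ m →
          ∃ λ (N : ℕ) → 0 < N × re ε ℚ.* L d ε (2 * k) ≡ ℕ→ℚ N × gcd m N ≡ 1)
      × ((a₀ : ℤ) → ¬ (ℤ.+ 2 ℤD.∣ a₀) → re ε ≡ a₀ ℚ./ 2 →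
          ∃ λ (N : ℕ) → 0 < N × ℤ→ℚ a₀ ℚ.* L d ε (2 * k) ≡ ℕ→ℚ N
            × gcd ∣ a₀ ∣ N ≡ 1)
corollary17 d _ _ (a , b) (unit@(((t , T≡t) , _) , _) , ε>1 , _) (suc j) _ =
  L-odd-integral j , (λ m _ → aL-even-coprime (suc j) m) , a₀L-even-coprime (suc j)
  where
  norm≡±1 : ∃ λ n → norm d (a , b) ≡ ℤ→ℚ n × (n ≡ 1ℤ ⊎ n ≡ -1ℤ)
  norm≡±1 = unit⇒norm≡±1 d (a , b) unit
  open UnitGreaterOne d a b t (proj₁ norm≡±1) T≡t (proj₁ (proj₂ norm≡±1)) (proj₂ (proj₂ norm≡±1)) ε>1
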